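{- A class of Kripke frames is $\mathrm{ML}(\mathsf{A}^+)$-definable if and only if it is definable by a set of closed disjunctive $\mathsf{A}$-clauses; that is, $\mathrm{ML}(\mathsf{A}^+)\equiv_F\bigvee\mathsf{A}\mathrm{ML}$.
   Context: Fix a set $\Phi$ of propositional variables. $\mathrm{ML}$-formulas: $\varphi ::= p \mid \neg p \mid (\varphi\wedge\varphi)\mid(\varphi\vee\varphi)\mid\Diamond\varphi\mid\Box\varphi$; $\mathrm{ML}(\mathsf{A}^+)$ adds $\varphi::=\mathsf{A}\varphi$, where $\mathfrak{M},w\Vdash\mathsf{A}\varphi$ iff $\varphi$ is true at every point of $\mathfrak{M}$. $\bigvee\mathsf{A}\mathrm{ML}$ is the set of closed disjunctive $\mathsf{A}$-clauses $\mathsf{A}\psi_1\vee\dots\vee\mathsf{A}\psi_n$ with $\psi_i\in\mathrm{ML}$. A set of formulas is valid in a frame if every formula is true at every point of every model on that frame; a class of frames is $L$-definable if it is the class of frames validating some set of $L$-formulas; $L\equiv_F L'$ means the $L$-definable and $L'$-definable frame classes coincide. -}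

module Defs where

open import Level using (Level; _⊔_) renaming (suc to lsuc; zero to 0ℓ)
open import Data.Product using (Σ; _×_)
open import Data.Sum using (_⊎_)
open import Data.List.NonEmpty using (List⁺; toList)
open import Data.List.Relation.Unary.Any using (Any)
open import Relation.Nullary using (¬_)
open import Function.Bundles using (_⇔_)

record Frame : Set₁ where
  field
    W : Set
    R : W → W → Set

open Frame public

FrameClass : Set₂
FrameClass = Frame → Set₁

module _ (Φ : Set) where

  Valuation : Frame → Set₁
  Valuation F = Φ → W F → Set

  -- ML formulas (negation normal form, as in the paper)
  data ML : Set where
    var  : Φ → ML
    nvar : Φ → ML
    _∧_  : ML → ML → ML
    _∨_  : ML → ML → ML
    ◇    : ML → ML
    □    : ML → ML

  data MLA : Set where
    var  : Φ → MLA
    nvar : Φ → MLA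
    _∧_  : MLA → MLA → MLA
    _∨_  : MLA → MLA → MLA
    ◇    : MLA → MLA
    □    : MLA → MLA
    A    : MLA → MLA

  -- closed disjunctive A-clauses  A ψ₁ ∨ … ∨ A ψₙ  (n ≥ 1, ψᵢ ∈ ML)
  AClause : Set
  AClause = List⁺ ML

  module _ (F : Frame) (V : Valuation F) where
    sat : W F → ML → Set
    sat w (var p)  = V p w
    sat w (nvar p) = ¬ V p w
    sat w (φ ∧ ψ)  = sat w φ × sat w ψ
    sat w (φ ∨ ψ)  = sat w φ ⊎ sat w ψ
    sat w (◇ φ)    = Σ (W F) λ v → R F w v × sat v φ
    sat w (□ φ)    = ∀ v → R F w v → sat v φ

    satA : W F → MLA → Set
    satA w (var p)  = V p w
    satA w (nvar p) = ¬ V p w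
    satA w (φ ∧ ψ)  = satA w φ × satA w ψ
    satA w (φ ∨ ψ)  = satA w φ ⊎ satA w ψ
    satA w (◇ φ)    = Σ (W F) λ v → R F w v × satA v φ
    satA w (□ φ)    = ∀ v → R F w v → satA v φ
    satA w (A φ)    = ∀ v → satA v φ

    satClause : W F → AClause → Set
    satClause w c = Any (λ ψ → ∀ v → sat v ψ) (toList c)

  ValidA : Frame → MLA → Set₁
  ValidA F φ = ∀ (V : Valuation F) (w : W F) → satA F V w φ

  ValidClause : Frame → AClause → Set₁
  ValidClause F c = ∀ (V : Valuation F) (w : W F) → satClause F V w c

  MLA-Definable : FrameClass → Set₁
  MLA-Definable K =
    Σ (MLA → Set) λ Γ → ∀ F → K F ⇔ (∀ φ → Γ φ → ValidA F φ)

  AClause-Definable : FrameClass → Set₁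
  AClause-Definable K =
    Σ (AClause → Set) λ Γ → ∀ F → K F ⇔ (∀ c → Γ c → ValidClause F c)

-- Over a fixed model, A φ has a single truth value, so every ML(A⁺) formula φ is equivalent to
-- α ∧ A κ for one of finitely many pairs (α, κ) of ML formulas computed from φ: the pair is
-- chosen by deciding which A-subformulas hold, classically.  Then φ is valid iff A(α ∧ κ)
-- holds for one of these pairs, i.e. iff the A-clause ⋁ A(α ∧ κ) is valid.  Conversely an
-- A-clause is itself an ML(A⁺) formula.
module Submission where

open import Defs
open import Level using (Level; 0ℓ)
open import Axiom.ExcludedMiddle using (ExcludedMiddle)
open import Function.Base using (_∘_)
open import Function.Bundles using (_⇔_; mk⇔; Equivalence)
open import Data.Product using (Σ; ∃; _×_; _,_; proj₁; proj₂)
open import Data.Sum using (inj₁; inj₂)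
open import Data.Empty using (⊥-elim)
open import Data.List using (List; []; _∷_; [_]; map; cartesianProductWith)
open import Data.List.NonEmpty using (foldr₁) renaming (_∷_ to _∷⁺_; map to map⁺)
open import Data.List.Relation.Unary.Any using (here; there)
open import Data.List.Membership.Propositional using (_∈_; find; lose)
import Data.List.Relation.Unary.Any.Properties as Any
open import Data.List.Membership.Propositional.Properties
  using (∈-map⁺; ∈-map⁻; ∈-cartesianProductWith⁺; ∈-cartesianProductWith⁻)
open import Relation.Nullary using (¬_; yes; no)
open import Relation.Binary.PropositionalEquality using (_≡_; refl)

open Equivalence using (to; from)

-- MLA-Definable Φ and AClause-Definable Φ unfold to Definable (ValidA Φ) and Definable (ValidClause Φ).
Definable : {Fm : Set} → (Frame → Fm → Set₁) → FrameClass → Set₁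
Definable {Fm} Valid K = Σ (Fm → Set) λ Γ → ∀ F → K F ⇔ (∀ φ → Γ φ → Valid F φ)

definable-transfer : {Fm Fm′ : Set} {Valid : Frame → Fm → Set₁} {Valid′ : Frame → Fm′ → Set₁}
  (t : Fm → Fm′) → (∀ F φ → Valid F φ ⇔ Valid′ F (t φ)) →
  ∀ {K} → Definable Valid K → Definable Valid′ K
definable-transfer t valid⇔ (Γ , K⇔Γ) = (λ ψ → ∃ λ φ → Γ φ × ψ ≡ t φ) , λ F → mk⇔
  (λ K-F → λ { _ (φ , φ∈Γ , refl) → to (valid⇔ F φ) (to (K⇔Γ F) K-F φ φ∈Γ) })
  (λ valid → from (K⇔Γ F) λ φ φ∈Γ → from (valid⇔ F φ) (valid (t φ) (φ , φ∈Γ , refl)))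

module _ {Φ : Set} where

  embed : ML Φ → MLA Φ
  embed (var p)  = var p
  embed (nvar p) = nvar p
  embed (φ ∧ ψ)  = embed φ ∧ embed ψ
  embed (φ ∨ ψ)  = embed φ ∨ embed ψ
  embed (◇ φ)    = ◇ (embed φ)
  embed (□ φ)    = □ (embed φ)

  ⋁A : AClause Φ → MLA Φ
  ⋁A c = foldr₁ _∨_ (map⁺ (A ∘ embed) c)

  module _ (F : Frame) (V : Valuation Φ F) where

    embed⁺ : ∀ ψ {w} → sat Φ F V w ψ → satA Φ F V w (embed ψ)
    embed⁺ (var p)  x           = x
    embed⁺ (nvar p) x           = x
    embed⁺ (φ ∧ ψ)  (x , y)     = embed⁺ φ x , embed⁺ ψ y
    embed⁺ (φ ∨ ψ)  (inj₁ x)    = inj₁ (embed⁺ φ x)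
    embed⁺ (φ ∨ ψ)  (inj₂ y)    = inj₂ (embed⁺ ψ y)
    embed⁺ (◇ φ)    (v , r , x) = v , r , embed⁺ φ x
    embed⁺ (□ φ)    x           = λ v r → embed⁺ φ (x v r)

    embed⁻ : ∀ ψ {w} → satA Φ F V w (embed ψ) → sat Φ F V w ψ
    embed⁻ (var p)  x           = x
    embed⁻ (nvar p) x           = x
    embed⁻ (φ ∧ ψ)  (x , y)     = embed⁻ φ x , embed⁻ ψ y
    embed⁻ (φ ∨ ψ)  (inj₁ x)    = inj₁ (embed⁻ φ x)
    embed⁻ (φ ∨ ψ)  (inj₂ y)    = inj₂ (embed⁻ ψ y)
    embed⁻ (◇ φ)    (v , r , x) = v , r , embed⁻ φ x
    embed⁻ (□ φ)    x           = λ v r → embed⁻ φ (x v r)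

    ⋁A⁺ : ∀ c {w} → satClause Φ F V w c → satA Φ F V w (⋁A c)
    ⋁A⁺ (ψ ∷⁺ [])     (here x)  = λ v → embed⁺ ψ (x v)
    ⋁A⁺ (ψ ∷⁺ χ ∷ χs) (here x)  = inj₁ λ v → embed⁺ ψ (x v)
    ⋁A⁺ (ψ ∷⁺ χ ∷ χs) (there x) = inj₂ (⋁A⁺ (χ ∷⁺ χs) x)

    ⋁A⁻ : ∀ c {w} → satA Φ F V w (⋁A c) → satClause Φ F V w c
    ⋁A⁻ (ψ ∷⁺ [])     x        = here λ v → embed⁻ ψ (x v)
    ⋁A⁻ (ψ ∷⁺ χ ∷ χs) (inj₁ x) = here λ v → embed⁻ ψ (x v)
    ⋁A⁻ (ψ ∷⁺ χ ∷ χs) (inj₂ x) = there (⋁A⁻ (χ ∷⁺ χs) x)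

  validClause⇔valid-⋁A : ∀ F c → ValidClause Φ F c ⇔ ValidA Φ F (⋁A c)
  validClause⇔valid-⋁A F c = mk⇔ (λ valid V w → ⋁A⁺ F V c (valid V w))
                                 (λ valid V w → ⋁A⁻ F V c (valid V w))

  someVariable : MLA Φ → Φ
  someVariable (var p)  = p
  someVariable (nvar p) = p
  someVariable (φ ∧ _)  = someVariable φ
  someVariable (φ ∨ _)  = someVariable φ
  someVariable (◇ φ)    = someVariable φ
  someVariable (□ φ)    = someVariable φ
  someVariable (A φ)    = someVariable φ

  -- The language has no constants, so ⊤ and ⊥ are expressed with a variable p.
  module _ (p : Φ) where

    ⊤ₚ ⊥ₚ : ML Φ
    ⊤ₚ = var p ∨ nvar p
    ⊥ₚ = var p ∧ nvar p

    record Guarded : Set where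
      constructor _∧A_
      field
        body guard : ML Φ

    open Guarded public

    flatten : Guarded → ML Φ
    flatten g = body g ∧ guard g

    _∧ᵍ_ _∨ᵍ_ : Guarded → Guarded → Guarded
    (α ∧A κ) ∧ᵍ (β ∧A λ′) = (α ∧ β) ∧A (κ ∧ λ′)
    (α ∧A κ) ∨ᵍ (β ∧A λ′) = (α ∨ β) ∧A (κ ∧ λ′)

    ◇ᵍ □ᵍ Aᵍ : Guarded → Guarded
    ◇ᵍ (α ∧A κ) = ◇ α ∧A κ
    □ᵍ (α ∧A κ) = □ α ∧A κ
    Aᵍ g        = ⊤ₚ ∧A flatten g

    normalForm : MLA Φ → List Guarded
    normalForm (var q)  = [ var q ∧A ⊤ₚ ]
    normalForm (nvar q) = [ nvar q ∧A ⊤ₚ ]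
    normalForm (φ ∧ ψ)  = cartesianProductWith _∧ᵍ_ (normalForm φ) (normalForm ψ)
    normalForm (φ ∨ ψ)  = cartesianProductWith _∨ᵍ_ (normalForm φ) (normalForm ψ)
    normalForm (◇ φ)    = map ◇ᵍ (normalForm φ)
    normalForm (□ φ)    = map □ᵍ (normalForm φ)
    normalForm (A φ)    = (⊥ₚ ∧A ⊤ₚ) ∷ map Aᵍ (normalForm φ)

    -- The ⊥ₚ disjunct is never valid; it only makes the clause non-empty.
    clause : MLA Φ → AClause Φ
    clause φ = ⊥ₚ ∷⁺ map flatten (normalForm φ)

    module _ (F : Frame) (V : Valuation Φ F) where

      private
        _⊩_ : W F → ML Φ → Set
        w ⊩ α = sat Φ F V w α

        _⊩ᴬ_ : W F → MLA Φ → Set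
        w ⊩ᴬ φ = satA Φ F V w φ

      Global : ML Φ → Set
      Global κ = ∀ v → v ⊩ κ

      ⊥ₚ-unsatisfiable : ∀ {w} → ¬ w ⊩ ⊥ₚ
      ⊥ₚ-unsatisfiable (x , ¬x) = ¬x x

      global-⊤ₚ : ExcludedMiddle 0ℓ → Global ⊤ₚ
      global-⊤ₚ em v with em {V p v}
      ... | yes x = inj₁ x
      ... | no ¬x = inj₂ ¬x

      normalForm-sound : ∀ φ {g} → g ∈ normalForm φ →
        Global (guard g) → ∀ {w} → w ⊩ body g → w ⊩ᴬ φ
      normalForm-sound (var q)  (here refl) _ x = x
      normalForm-sound (nvar q) (here refl) _ x = x
      normalForm-sound (φ ∧ ψ) g∈
        with _ , _ , g₁∈ , g₂∈ , refl ← ∈-cartesianProductWith⁻ _∧ᵍ_ (normalForm φ) (normalForm ψ) g∈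
        = λ κλ (x , y) → normalForm-sound φ g₁∈ (proj₁ ∘ κλ) x , normalForm-sound ψ g₂∈ (proj₂ ∘ κλ) y
      normalForm-sound (φ ∨ ψ) g∈
        with _ , _ , g₁∈ , g₂∈ , refl ← ∈-cartesianProductWith⁻ _∨ᵍ_ (normalForm φ) (normalForm ψ) g∈
        = λ { κλ (inj₁ x) → inj₁ (normalForm-sound φ g₁∈ (proj₁ ∘ κλ) x)
            ; κλ (inj₂ y) → inj₂ (normalForm-sound ψ g₂∈ (proj₂ ∘ κλ) y) }
      normalForm-sound (◇ φ) g∈ with _ , g′∈ , refl ← ∈-map⁻ ◇ᵍ g∈
        = λ { κ (v , r , x) → v , r , normalForm-sound φ g′∈ κ x }
      normalForm-sound (□ φ) g∈ with _ , g′∈ , refl ← ∈-map⁻ □ᵍ g∈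
        = λ κ x v r → normalForm-sound φ g′∈ κ (x v r)
      normalForm-sound (A φ) (here refl) _ x = ⊥-elim (⊥ₚ-unsatisfiable x)
      normalForm-sound (A φ) (there g∈) with _ , g′∈ , refl ← ∈-map⁻ Aᵍ g∈
        = λ ακ _ v → normalForm-sound φ g′∈ (proj₂ ∘ ακ) (proj₁ (ακ v))

      normalForm-complete : ExcludedMiddle 0ℓ → ∀ φ → ∃ λ g → g ∈ normalForm φ ×
        Global (guard g) × (∀ {w} → w ⊩ᴬ φ → w ⊩ body g)
      normalForm-complete em (var q)  = _ , here refl , global-⊤ₚ em , λ x → x
      normalForm-complete em (nvar q) = _ , here refl , global-⊤ₚ em , λ x → x
      normalForm-complete em (φ ∧ ψ)
        with g₁ , g₁∈ , κ₁ , c₁ ← normalForm-complete em φ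
           | g₂ , g₂∈ , κ₂ , c₂ ← normalForm-complete em ψ
        = g₁ ∧ᵍ g₂ , ∈-cartesianProductWith⁺ _∧ᵍ_ g₁∈ g₂∈ , (λ v → κ₁ v , κ₂ v) ,
          λ (x , y) → c₁ x , c₂ y
      normalForm-complete em (φ ∨ ψ)
        with g₁ , g₁∈ , κ₁ , c₁ ← normalForm-complete em φ
           | g₂ , g₂∈ , κ₂ , c₂ ← normalForm-complete em ψ
        = g₁ ∨ᵍ g₂ , ∈-cartesianProductWith⁺ _∨ᵍ_ g₁∈ g₂∈ , (λ v → κ₁ v , κ₂ v) ,
          λ { (inj₁ x) → inj₁ (c₁ x) ; (inj₂ y) → inj₂ (c₂ y) }
      normalForm-complete em (◇ φ) with g , g∈ , κ , c ← normalForm-complete em φ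
        = ◇ᵍ g , ∈-map⁺ ◇ᵍ g∈ , κ , λ (v , r , x) → v , r , c x
      normalForm-complete em (□ φ) with g , g∈ , κ , c ← normalForm-complete em φ
        = □ᵍ g , ∈-map⁺ □ᵍ g∈ , κ , λ x v r → c (x v r)
      normalForm-complete em (A φ) with em {∀ v → v ⊩ᴬ φ}
      ... | no ¬valid = _ , here refl , global-⊤ₚ em , λ valid → ⊥-elim (¬valid valid)
      ... | yes valid with g , g∈ , κ , c ← normalForm-complete em φ
        = Aᵍ g , there (∈-map⁺ Aᵍ g∈) , (λ v → c (valid v) , κ v) , λ _ → global-⊤ₚ em _

    valid⇔validClause : ExcludedMiddle 0ℓ → ∀ F φ → ValidA Φ F φ ⇔ ValidClause Φ F (clause φ)
    valid⇔validClause em F φ = mk⇔ valid⇒validClause validClause⇒valid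
      where
      valid⇒validClause : ValidA Φ F φ → ValidClause Φ F (clause φ)
      valid⇒validClause valid V _ with g , g∈ , κ , c ← normalForm-complete F V em φ
        = there (Any.map⁺ (lose g∈ λ v → c (valid V v) , κ v))

      validClause⇒valid : ValidClause Φ F (clause φ) → ValidA Φ F φ
      validClause⇒valid validClause V w with validClause V w
      ... | here ⊥ₚ-global = ⊥-elim (⊥ₚ-unsatisfiable F V (⊥ₚ-global w))
      ... | there flattened-global with g , g∈ , ακ ← find (Any.map⁻ flattened-global)
        = normalForm-sound F V φ g∈ (proj₂ ∘ ακ) (proj₁ (ακ w))

propositionA2 : (∀ {ℓ : Level} → ExcludedMiddle ℓ) →
    (Φ : Set) → (K : FrameClass) →
    MLA-Definable Φ K ⇔ AClause-Definable Φ K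
propositionA2 em Φ K = mk⇔
  (definable-transfer (λ φ → clause (someVariable φ) φ)
    λ F φ → valid⇔validClause (someVariable φ) em F φ)
  (definable-transfer ⋁A validClause⇔valid-⋁A)
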